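{- Let $\phi=\frac12(1+\sqrt5)$, $F_j$ the Fibonacci numbers ($F_1=F_2=1$), and for $n\ge0$ let $G_n(x)=\prod_{i=0}^{n-1}\left(1+x^{\phi^i}\right)$ (a finite sum of terms $c\,x^{e}$ with exponents $e\in\mathbb{Z}[\phi]$, $e\ge 0$) and $I_n(x)=\prod_{i=1}^n\left(1+x^{F_{i+1}}\right)$. Then the sequence of coefficients of $G_n(x)$ equals the sequence of coefficients of $I_n(x)$. Moreover, if the coefficient of $x^k$ in $I_n(x)$ is $0$, then $k>\deg I_n(x)$.
   Context: For a finite sum $P(x)=\sum_{i\ge0}c_ix^{m_i}$ with real exponents $0\le m_0<m_1<\cdots$ and all $c_i\neq0$, the sequence of coefficients of $P(x)$ is $(c_0,c_1,\dots)$, i.e. the nonzero coefficients listed in increasing order of exponent. -}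

module Defs where

open import Level using (0ℓ)
open import Data.Nat as ℕ using (ℕ; zero; suc; _⊔_)
open import Data.Integer as ℤ using (ℤ; +_; 0ℤ)
open import Data.Product using (Σ; _×_; _,_)
open import Data.Product.Properties using (≡-dec)
open import Data.Sum using (_⊎_)
open import Data.List using (List; []; _∷_; _++_; map; upTo; foldr; filter; length)
open import Data.List.Relation.Unary.AllPairs using (AllPairs)
open import Data.List.Membership.Propositional using (_∈_)
open import Relation.Binary using (Rel; DecidableEquality)
open import Relation.Binary.PropositionalEquality using (_≡_; _≢_)
open import Relation.Nullary using (¬_)

-- Generalised polynomials with nonnegative integer coefficients, given
-- as the list of their monomials (each monomial x^e with coefficient 1,
-- repeated exponents add up).

-- Expansion of  ∏_{a ∈ as} (1 + x^a)  as the list of its monomial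
-- exponents (one entry per subset of the factors).
expand : {E : Set} → (E → E → E) → E → List E → List E
expand add z [] = z ∷ []
expand add z (a ∷ as) = r ++ map (add a) r
  where r = expand add z as

coeff : {E : Set} → DecidableEquality E → List E → E → ℕ
coeff _≟_ ts e = length (filter (e ≟_) ts)

IsCoeffSeq : {E : Set} → Rel E 0ℓ → DecidableEquality E → List E → List ℕ → Set
IsCoeffSeq {E} _<_ _≟_ ts cs =
  Σ (List E) λ es →
    AllPairs _<_ es
    × (∀ e → (e ∈ es → coeff _≟_ ts e ≢ 0) × (coeff _≟_ ts e ≢ 0 → e ∈ es))
    × cs ≡ map (coeff _≟_ ts) es

degℕ : List ℕ → ℕ
degℕ = foldr _⊔_ 0

-- ℤ[φ], φ = (1+√5)/2, represented as pairs (a , b) meaning a + bφ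
-- (unique representation since φ is irrational).

Zφ : Set
Zφ = ℤ × ℤ

_+φ_ : Zφ → Zφ → Zφ
(a , b) +φ (c , d) = (a ℤ.+ c , b ℤ.+ d)

0φ : Zφ
0φ = (0ℤ , 0ℤ)

_≟φ_ : DecidableEquality Zφ
_≟φ_ = ≡-dec ℤ._≟_ ℤ._≟_

-- φ^i, using φ·(a + bφ) = b + (a + b)φ  (since φ² = φ + 1)
φ^ : ℕ → Zφ
φ^ zero = (+ 1 , 0ℤ)
φ^ (suc i) with φ^ i
... | (a , b) = (b , a ℤ.+ b)

-- x + yφ > 0 as a real number.  With p = 2x + y, q = y we have
-- 2(x + yφ) = p + q√5, whose sign is decided as below.
Posφ : Zφ → Set
Posφ (x , y) = PosAux ((+ 2) ℤ.* x ℤ.+ y) y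
  where
  PosAux : ℤ → ℤ → Set
  PosAux p q =
      (0ℤ ℤ.≤ p × 0ℤ ℤ.≤ q × ¬ (p ≡ 0ℤ × q ≡ 0ℤ))
    ⊎ (0ℤ ℤ.< p × q ℤ.< 0ℤ × (+ 5) ℤ.* (q ℤ.* q) ℤ.< p ℤ.* p)
    ⊎ (p ℤ.< 0ℤ × 0ℤ ℤ.< q × p ℤ.* p ℤ.< (+ 5) ℤ.* (q ℤ.* q))

_<φ_ : Rel Zφ 0ℓ
(a , b) <φ (c , d) = Posφ (c ℤ.- a , d ℤ.- b)

fib : ℕ → ℕ
fib zero = 0
fib (suc zero) = 1
fib (suc (suc n)) = fib n ℕ.+ fib (suc n)

termsG : ℕ → List Zφ
termsG n = expand _+φ_ 0φ (map φ^ (upTo n))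

termsI : ℕ → List ℕ
termsI n = expand ℕ._+_ 0 (map (λ j → fib (suc (suc j))) (upTo n))

-- The additive map x + yφ ↦ x + 2y sends φ^i to F_{i+2}, hence the exponents of G_n
-- onto those of I_n, with multiplicities.  It is injective and strictly monotone on
-- the exponents of G_n.  Indeed, for the difference d of two of them, the Galois
-- conjugate d̄ satisfies |d̄| ≤ Σ_{i<n} φ^{-i} < φ²; if d ↦ 0 this forces d = 0,
-- and if d ↦ k ≥ 1 then φ⁴d = (φ² + d̄) + ((k - 1) + (3k - 1)φ) > 0.  Finally the
-- sums of distinct F_2, …, F_{n+1} are exactly the integers 0 … F_{n+3} - 2.

{-# OPTIONS --safe #-}
module Submission where

open import Defs
open import Data.Nat as ℕ using (ℕ; zero; suc; z≤n; s≤s; _≤_; _<_)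
import Data.Nat.Properties as ℕP
open import Data.Nat.ListAction using (sum)
open import Data.Nat.ListAction.Properties using (sum-++)
import Data.Nat.Tactic.RingSolver as ℕSolver
open import Data.Integer as ℤ using (ℤ; +_; -[1+_]; +[1+_]; 0ℤ; +≤+; +<+; -<+)
import Data.Integer.Properties as ℤP
open import Data.Integer.Tactic.RingSolver using (solve-∀)
open import Algebra.Properties.CommutativeSemigroup ℤP.+-commutativeSemigroup
  using (interchange; x∙yz≈y∙xz)
open import Data.List using (List; []; _∷_; _++_; [_]; map; upTo)
import Data.List.Properties as List
open import Data.List.Membership.Propositional using (_∈_)
open import Data.List.Membership.Propositional.Properties
  using (∈-++⁻; ∈-++⁺ˡ; ∈-++⁺ʳ; ∈-map⁺; ∈-map⁻; ∈-upTo⁺; ∈-upTo⁻)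
open import Data.List.Relation.Unary.Any using (here; there)
open import Data.List.Relation.Unary.All as All using (All; []; _∷_)
open import Data.List.Relation.Unary.AllPairs using (AllPairs; []; _∷_)
import Data.List.Relation.Unary.AllPairs.Properties as AllPairs
open import Data.Product using (Σ; ∃; _×_; _,_; proj₁; proj₂)
open import Data.Sum using (_⊎_; inj₁; inj₂)
open import Data.Empty using (⊥-elim)
open import Function using (id; _∘_)
open import Relation.Binary using (DecidableEquality)
open import Relation.Binary.PropositionalEquality hiding ([_])
open import Relation.Nullary using (¬_; yes; no)

module _ {A : Set} (_≟_ : DecidableEquality A) where

  ∈⇒coeff≢0 : ∀ {xs e} → e ∈ xs → coeff _≟_ xs e ≢ 0
  ∈⇒coeff≢0 {x ∷ xs} {e} e∈ with e ≟ x
  ... | yes _ = λ ()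
  ∈⇒coeff≢0 {x ∷ xs} (here e≡x) | no e≢x = ⊥-elim (e≢x e≡x)
  ∈⇒coeff≢0 {x ∷ xs} (there e∈xs) | no _ = ∈⇒coeff≢0 e∈xs

  coeff≢0⇒∈ : ∀ xs {e} → coeff _≟_ xs e ≢ 0 → e ∈ xs
  coeff≢0⇒∈ [] c≢0 = ⊥-elim (c≢0 refl)
  coeff≢0⇒∈ (x ∷ xs) {e} c≢0 with e ≟ x
  ... | yes e≡x = here e≡x
  ... | no _ = there (coeff≢0⇒∈ xs c≢0)

coeff-map : ∀ {A B : Set} (_≟A_ : DecidableEquality A) (_≟B_ : DecidableEquality B)
  (g : A → B) {t} xs → (∀ {s} → s ∈ xs → g s ≡ g t → s ≡ t) →
  coeff _≟B_ (map g xs) (g t) ≡ coeff _≟A_ xs t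
coeff-map _≟A_ _≟B_ g [] _ = refl
coeff-map _≟A_ _≟B_ g {t} (x ∷ xs) inj with g t ≟B g x | t ≟A x
... | yes _ | yes _ = cong suc (coeff-map _≟A_ _≟B_ g xs (inj ∘ there))
... | no _ | no _ = coeff-map _≟A_ _≟B_ g xs (inj ∘ there)
... | yes gt≡gx | no t≢x = ⊥-elim (t≢x (sym (inj (here refl) (sym gt≡gx))))
... | no gt≢gx | yes t≡x = ⊥-elim (gt≢gx (cong g t≡x))

module _ {A : Set} {_<A_ : A → A → Set} (_≟A_ : DecidableEquality A)
  (g : A → ℕ) (ts : List A)
  (g-injective : ∀ {s t} → s ∈ ts → t ∈ ts → g s ≡ g t → s ≡ t)
  (g-reflects-< : ∀ {s t} → s ∈ ts → t ∈ ts → g s < g t → s <A t) where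

  private
    preimages : ∀ {ks} → All (_∈ map g ts) ks → List A
    preimages [] = []
    preimages (k∈ ∷ ps) = proj₁ (∈-map⁻ g k∈) ∷ preimages ps

    preimages-⊆ : ∀ {ks} (ps : All (_∈ map g ts) ks) → All (_∈ ts) (preimages ps)
    preimages-⊆ [] = []
    preimages-⊆ (k∈ ∷ ps) = proj₁ (proj₂ (∈-map⁻ g k∈)) ∷ preimages-⊆ ps

    map-preimages : ∀ {ks} (ps : All (_∈ map g ts) ks) → map g (preimages ps) ≡ ks
    map-preimages [] = refl
    map-preimages (k∈ ∷ ps) = cong₂ _∷_ (sym (proj₂ (proj₂ (∈-map⁻ g k∈)))) (map-preimages ps)

    AllPairs-reflect : ∀ {xs} → All (_∈ ts) xs → AllPairs (λ s t → g s < g t) xs → AllPairs _<A_ xs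
    AllPairs-reflect [] [] = []
    AllPairs-reflect (x∈ ∷ xs⊆) (x< ∷ xs<) =
      All.zipWith (λ (y∈ , gx<gy) → g-reflects-< x∈ y∈ gx<gy) (xs⊆ , x<) ∷ AllPairs-reflect xs⊆ xs<

  IsCoeffSeq-map⁻ : ∀ {cs} → IsCoeffSeq ℕ._<_ ℕ._≟_ (map g ts) cs → IsCoeffSeq _<A_ _≟A_ ts cs
  IsCoeffSeq-map⁻ {cs} (ks , ks↑ , ks-support , cs≡) = as , as↑ , as-support , cs≡′
    where
    ks⊆ : All (_∈ map g ts) ks
    ks⊆ = All.tabulate λ k∈ → coeff≢0⇒∈ ℕ._≟_ (map g ts) (proj₁ (ks-support _) k∈)
    as = preimages ks⊆
    as⊆ = preimages-⊆ ks⊆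

    as↑ : AllPairs _<A_ as
    as↑ = AllPairs-reflect as⊆ (AllPairs.map⁻ (subst (AllPairs ℕ._<_) (sym (map-preimages ks⊆)) ks↑))

    as-complete : ∀ {e} → e ∈ ts → e ∈ as
    as-complete {e} e∈ts with ∈-map⁻ g (subst (g e ∈_) (sym (map-preimages ks⊆))
                                 (proj₂ (ks-support (g e)) (∈⇒coeff≢0 ℕ._≟_ (∈-map⁺ g e∈ts))))
    ... | a , a∈as , ge≡ga = subst (_∈ as) (g-injective (All.lookup as⊆ a∈as) e∈ts (sym ge≡ga)) a∈as

    as-support : ∀ e → (e ∈ as → coeff _≟A_ ts e ≢ 0) × (coeff _≟A_ ts e ≢ 0 → e ∈ as)
    as-support e = (∈⇒coeff≢0 _≟A_ ∘ All.lookup as⊆) , (as-complete ∘ coeff≢0⇒∈ _≟A_ ts)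

    cs≡′ : cs ≡ map (coeff _≟A_ ts) as
    cs≡′ = begin
      cs                                        ≡⟨ cs≡ ⟩
      map (coeff ℕ._≟_ (map g ts)) ks           ≡⟨ cong (map _) (map-preimages ks⊆) ⟨
      map (coeff ℕ._≟_ (map g ts)) (map g as)   ≡⟨ List.map-∘ as ⟨
      map (coeff ℕ._≟_ (map g ts) ∘ g) as       ≡⟨ List.map-cong-local (All.map coeff-g as⊆) ⟩
      map (coeff _≟A_ ts) as                    ∎
      where
      open ≡-Reasoning
      coeff-g : ∀ {a} → a ∈ ts → coeff ℕ._≟_ (map g ts) (g a) ≡ coeff _≟A_ ts a
      coeff-g a∈ = coeff-map _≟A_ ℕ._≟_ g ts (λ s∈ → g-injective s∈ a∈)

degℕ-≤ : ∀ ts {D} → (∀ {k} → k ∈ ts → k ≤ D) → degℕ ts ≤ D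
degℕ-≤ [] _ = z≤n
degℕ-≤ (t ∷ ts) ts≤D = ℕP.⊔-lub (ts≤D (here refl)) (degℕ-≤ ts (ts≤D ∘ there))

module _ (ts : List ℕ) (D : ℕ)
  (ts≤D : ∀ {k} → k ∈ ts → k ≤ D) (≤D⇒∈ts : ∀ {k} → k ≤ D → k ∈ ts) where

  IsCoeffSeq-interval : IsCoeffSeq ℕ._<_ ℕ._≟_ ts (map (coeff ℕ._≟_ ts) (upTo (suc D)))
  IsCoeffSeq-interval =
    upTo (suc D) , AllPairs.applyUpTo⁺₁ id (suc D) (λ i<j _ → i<j) , support , refl
    where
    support : ∀ e → (e ∈ upTo (suc D) → coeff ℕ._≟_ ts e ≢ 0) × (coeff ℕ._≟_ ts e ≢ 0 → e ∈ upTo (suc D))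
    support e = (∈⇒coeff≢0 ℕ._≟_ ∘ ≤D⇒∈ts ∘ ℕP.m<1+n⇒m≤n ∘ ∈-upTo⁻)
              , (∈-upTo⁺ ∘ s≤s ∘ ts≤D ∘ coeff≢0⇒∈ ℕ._≟_ ts)

  coeff≡0⇒degℕ< : ∀ {k} → coeff ℕ._≟_ ts k ≡ 0 → degℕ ts < k
  coeff≡0⇒degℕ< {k} c≡0 with k ℕ.≤? D
  ... | yes k≤D = ⊥-elim (∈⇒coeff≢0 ℕ._≟_ (≤D⇒∈ts k≤D) c≡0)
  ... | no k≰D = ℕP.≤-<-trans (degℕ-≤ ts ts≤D) (ℕP.≰⇒> k≰D)

-- Expansions and the exponents of I_n

expand-map : ∀ {A B : Set} {_+A_ : A → A → A} {_+B_ : B → B → B} {zA zB} (h : A → B) →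
  h zA ≡ zB → (∀ a b → h (a +A b) ≡ h a +B h b) →
  ∀ as → map h (expand _+A_ zA as) ≡ expand _+B_ zB (map h as)
expand-map h h-zero h-+ [] = cong [_] h-zero
expand-map {_+A_ = _+A_} {_+B_} {zA} {zB} h h-zero h-+ (a ∷ as) = begin
  map h (r ++ map (a +A_) r)                  ≡⟨ List.map-++ h r (map (a +A_) r) ⟩
  map h r ++ map h (map (a +A_) r)            ≡⟨ cong (map h r ++_) (List.map-∘ r) ⟨
  map h r ++ map (h ∘ (a +A_)) r              ≡⟨ cong (map h r ++_) (List.map-cong (h-+ a) r) ⟩
  map h r ++ map ((h a +B_) ∘ h) r            ≡⟨ cong (map h r ++_) (List.map-∘ r) ⟩
  map h r ++ map (h a +B_) (map h r)          ≡⟨ cong (λ r′ → r′ ++ map (h a +B_) r′) IH ⟩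
  expand _+B_ zB (map h (a ∷ as))             ∎
  where
  open ≡-Reasoning
  r = expand _+A_ zA as
  IH = expand-map h h-zero h-+ as

∈-expand⇒≤-sum : ∀ as {x} → x ∈ expand ℕ._+_ 0 as → x ≤ sum as
∈-expand⇒≤-sum [] (here refl) = z≤n
∈-expand⇒≤-sum (a ∷ as) x∈ with ∈-++⁻ (expand ℕ._+_ 0 as) x∈
... | inj₁ x∈r = ℕP.m≤n⇒m≤o+n a (∈-expand⇒≤-sum as x∈r)
... | inj₂ x∈ar with ∈-map⁻ (a ℕ.+_) x∈ar
...   | y , y∈r , refl = ℕP.+-monoʳ-≤ a (∈-expand⇒≤-sum as y∈r)

∈-expand-++ : ∀ as bs {y z} → y ∈ expand ℕ._+_ 0 as → z ∈ expand ℕ._+_ 0 bs →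
  y ℕ.+ z ∈ expand ℕ._+_ 0 (as ++ bs)
∈-expand-++ [] bs (here refl) z∈ = z∈
∈-expand-++ (a ∷ as) bs {z = z} y∈ z∈ with ∈-++⁻ (expand ℕ._+_ 0 as) y∈
... | inj₁ y∈r = ∈-++⁺ˡ (∈-expand-++ as bs y∈r z∈)
... | inj₂ y∈ar with ∈-map⁻ (a ℕ.+_) y∈ar
...   | y′ , y′∈r , refl = ∈-++⁺ʳ (expand ℕ._+_ 0 (as ++ bs))
        (subst (_∈ map (a ℕ.+_) (expand ℕ._+_ 0 (as ++ bs))) (sym (ℕP.+-assoc a y′ z))
          (∈-map⁺ (a ℕ.+_) (∈-expand-++ as bs y′∈r z∈)))

SubsetSumsCover : List ℕ → Set
SubsetSumsCover as = ∀ {k} → k ≤ sum as → k ∈ expand ℕ._+_ 0 as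

SubsetSumsCover-∷ʳ : ∀ as {a} → a ≤ suc (sum as) → SubsetSumsCover as → SubsetSumsCover (as ++ [ a ])
SubsetSumsCover-∷ʳ as {a} a≤ cover {k} k≤ with k ℕ.≤? sum as
... | yes k≤s = subst (_∈ _) (ℕP.+-identityʳ k) (∈-expand-++ as [ a ] (cover k≤s) (here refl))
... | no k≰s = subst (_∈ _) k∸a+a≡k (∈-expand-++ as [ a ] (cover k∸a≤s) (there (here refl)))
  where
  a≤k : a ≤ k
  a≤k = ℕP.≤-trans a≤ (ℕP.≰⇒> k≰s)
  k∸a+a≡k : k ℕ.∸ a ℕ.+ (a ℕ.+ 0) ≡ k
  k∸a+a≡k = trans (cong (k ℕ.∸ a ℕ.+_) (ℕP.+-identityʳ a)) (ℕP.m∸n+n≡m a≤k)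
  sum-∷ʳ : sum (as ++ [ a ]) ≡ sum as ℕ.+ a
  sum-∷ʳ = trans (sum-++ as [ a ]) (cong (sum as ℕ.+_) (ℕP.+-identityʳ a))
  k∸a≤s : k ℕ.∸ a ≤ sum as
  k∸a≤s = subst (k ℕ.∸ a ≤_) (ℕP.m+n∸n≡m (sum as) a) (ℕP.∸-monoˡ-≤ a (subst (k ≤_) sum-∷ʳ k≤))

fibs : ℕ → List ℕ
fibs n = map (λ j → fib (suc (suc j))) (upTo n)

fibs-suc : ∀ n → fibs (suc n) ≡ fibs n ++ [ fib (suc (suc n)) ]
fibs-suc n = trans (cong (map _) (sym (List.upTo-∷ʳ n))) (List.map-++ _ (upTo n) [ n ])

sum-fibs : ∀ n → sum (fibs n) ℕ.+ 2 ≡ fib (3 ℕ.+ n)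
sum-fibs zero = refl
sum-fibs (suc n) = begin
  sum (fibs (suc n)) ℕ.+ 2              ≡⟨ cong (λ l → sum l ℕ.+ 2) (fibs-suc n) ⟩
  sum (fibs n ++ [ F ]) ℕ.+ 2           ≡⟨ cong (ℕ._+ 2) (sum-++ (fibs n) [ F ]) ⟩
  sum (fibs n) ℕ.+ (F ℕ.+ 0) ℕ.+ 2      ≡⟨ rearrange (sum (fibs n)) F ⟩
  F ℕ.+ (sum (fibs n) ℕ.+ 2)            ≡⟨ cong (F ℕ.+_) (sum-fibs n) ⟩
  fib (4 ℕ.+ n)                          ∎
  where
  open ≡-Reasoning
  F = fib (suc (suc n))
  rearrange : ∀ s f → s ℕ.+ (f ℕ.+ 0) ℕ.+ 2 ≡ f ℕ.+ (s ℕ.+ 2)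
  rearrange = ℕSolver.solve-∀

fib-pos : ∀ n → 1 ≤ fib (suc n)
fib-pos zero = s≤s z≤n
fib-pos (suc n) = ℕP.m≤n⇒m≤o+n (fib n) (fib-pos n)

SubsetSumsCover-fibs : ∀ n → SubsetSumsCover (fibs n)
SubsetSumsCover-fibs zero z≤n = here refl
SubsetSumsCover-fibs (suc n) =
  subst SubsetSumsCover (sym (fibs-suc n)) (SubsetSumsCover-∷ʳ (fibs n) F≤ (SubsetSumsCover-fibs n))
  where
  F≤ : fib (suc (suc n)) ≤ suc (sum (fibs n))
  F≤ = ℕ.s≤s⁻¹ (subst (suc (fib (suc (suc n))) ≤_)
                  (trans (sym (sum-fibs n)) (ℕP.+-comm (sum (fibs n)) 2))
                  (ℕP.+-monoˡ-≤ (fib (suc (suc n))) (fib-pos n)))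

private
  0<j-i⇒i<j : ∀ i j → 0ℤ ℤ.< j ℤ.- i → i ℤ.< j
  0<j-i⇒i<j i j h = subst₂ ℤ._<_ (ℤP.+-identityʳ i) (lemma i j) (ℤP.+-mono-≤-< (ℤP.≤-refl {i}) h)
    where
    lemma : ∀ i j → i ℤ.+ (j ℤ.- i) ≡ j
    lemma = solve-∀

  i<j⇒0<j-i : ∀ i j → i ℤ.< j → 0ℤ ℤ.< j ℤ.- i
  i<j⇒0<j-i i j h = subst (ℤ._< j ℤ.- i) (ℤP.+-inverseʳ i) (ℤP.+-mono-<-≤ h (ℤP.≤-refl {ℤ.- i}))

  0≤i*j : ∀ {i j} → 0ℤ ℤ.≤ i → 0ℤ ℤ.≤ j → 0ℤ ℤ.≤ i ℤ.* j
  0≤i*j {+ m} {+ n} _ _ = subst (0ℤ ℤ.≤_) (ℤP.pos-* m n) (+≤+ z≤n)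

  0<i*j : ∀ {i j} → 0ℤ ℤ.< i → 0ℤ ℤ.< j → 0ℤ ℤ.< i ℤ.* j
  0<i*j {+[1+ m ]} {+[1+ n ]} (+<+ _) (+<+ _) = +<+ (s≤s z≤n)

  i<0⇒0<-i : ∀ {i} → i ℤ.< 0ℤ → 0ℤ ℤ.< ℤ.- i
  i<0⇒0<-i { -[1+ n ]} -<+ = +<+ (s≤s z≤n)

  0<-i⇒i<0 : ∀ {i} → 0ℤ ℤ.< ℤ.- i → i ℤ.< 0ℤ
  0<-i⇒i<0 { -[1+ n ]} _ = -<+
  0<-i⇒i<0 {+ zero} (+<+ ())

  0<2*i⇒0<i : ∀ i → 0ℤ ℤ.< (+ 2) ℤ.* i → 0ℤ ℤ.< i
  0<2*i⇒0<i (+ zero) (+<+ ())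
  0<2*i⇒0<i +[1+ n ] _ = +<+ (s≤s z≤n)

  0<-by : ∀ {i j} → i ≡ j → 0ℤ ℤ.< j → 0ℤ ℤ.< i
  0<-by eq = subst (0ℤ ℤ.<_) (sym eq)

  2*i≡0⇒i≡0 : ∀ {i} → 0ℤ ℤ.≤ i → (+ 2) ℤ.* i ≡ 0ℤ → i ≡ 0ℤ
  2*i≡0⇒i≡0 {+ zero} _ _ = refl
  2*i≡0⇒i≡0 {+[1+ n ]} _ ()

  0<1+i⇒0≤i : ∀ i → 0ℤ ℤ.< + 1 ℤ.+ i → 0ℤ ℤ.≤ i
  0<1+i⇒0≤i (+ n) _ = +≤+ z≤n
  0<1+i⇒0≤i -[1+ zero ] (+<+ ())
  0<1+i⇒0≤i -[1+ suc n ] ()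

-- Arithmetic in ℤ[φ]

-φ_ : Zφ → Zφ
-φ (a , b) = (ℤ.- a , ℤ.- b)

_-φ_ : Zφ → Zφ → Zφ
α -φ β = α +φ (-φ β)

φ* : Zφ → Zφ
φ* (a , b) = (b , a ℤ.+ b)

-- multiplication by φ⁻¹ = φ - 1
φ⁻¹* : Zφ → Zφ
φ⁻¹* (a , b) = (b ℤ.- a , a)

-- the Galois conjugation φ ↦ 1 - φ
conj : Zφ → Zφ
conj (a , b) = (a ℤ.+ b , ℤ.- b)

φ² : Zφ
φ² = (+ 1 , + 1)

+φ-assoc : ∀ α β γ → (α +φ β) +φ γ ≡ α +φ (β +φ γ)
+φ-assoc (a , b) (c , d) (e , f) = cong₂ _,_ (ℤP.+-assoc a c e) (ℤP.+-assoc b d f)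

+φ-identityˡ : ∀ α → 0φ +φ α ≡ α
+φ-identityˡ (a , b) = cong₂ _,_ (ℤP.+-identityˡ a) (ℤP.+-identityˡ b)

+φ-identityʳ : ∀ α → α +φ 0φ ≡ α
+φ-identityʳ (a , b) = cong₂ _,_ (ℤP.+-identityʳ a) (ℤP.+-identityʳ b)

+φ-inverseʳ : ∀ α → α -φ α ≡ 0φ
+φ-inverseʳ (a , b) = cong₂ _,_ (ℤP.+-inverseʳ a) (ℤP.+-inverseʳ b)

+φ-interchange : ∀ α β γ δ → (α +φ β) +φ (γ +φ δ) ≡ (α +φ γ) +φ (β +φ δ)
+φ-interchange (a , a′) (b , b′) (c , c′) (d , d′) =
  cong₂ _,_ (interchange a b c d) (interchange a′ b′ c′ d′)

+φ-left-comm : ∀ α β γ → α +φ (β +φ γ) ≡ β +φ (α +φ γ)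
+φ-left-comm (a , a′) (b , b′) (c , c′) = cong₂ _,_ (x∙yz≈y∙xz a b c) (x∙yz≈y∙xz a′ b′ c′)

-φ-involutive : ∀ α → -φ (-φ α) ≡ α
-φ-involutive (a , b) = cong₂ _,_ (ℤP.neg-involutive a) (ℤP.neg-involutive b)

-φ-+ : ∀ α β → -φ (α +φ β) ≡ (-φ α) +φ (-φ β)
-φ-+ (a , a′) (b , b′) = cong₂ _,_ (ℤP.neg-distrib-+ a b) (ℤP.neg-distrib-+ a′ b′)

φ*-+ : ∀ α β → φ* (α +φ β) ≡ φ* α +φ φ* β
φ*-+ (a , b) (c , d) = cong₂ _,_ refl (interchange a c b d)

φ⁻¹*-+ : ∀ α β → φ⁻¹* (α +φ β) ≡ φ⁻¹* α +φ φ⁻¹* β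
φ⁻¹*-+ (a , b) (c , d) = cong₂ _,_ (lemma a b c d) refl
  where
  lemma : ∀ a b c d → (b ℤ.+ d) ℤ.- (a ℤ.+ c) ≡ (b ℤ.- a) ℤ.+ (d ℤ.- c)
  lemma = solve-∀

φ*-φ⁻¹* : ∀ α → φ* (φ⁻¹* α) ≡ α
φ*-φ⁻¹* (a , b) = cong₂ _,_ refl (lemma a b)
  where
  lemma : ∀ a b → (b ℤ.- a) ℤ.+ a ≡ b
  lemma = solve-∀

conj-φ* : ∀ α → conj (φ* α) ≡ -φ (φ⁻¹* (conj α))
conj-φ* (a , b) = cong₂ _,_ (lemma a b) refl
  where
  lemma : ∀ a b → b ℤ.+ (a ℤ.+ b) ≡ ℤ.- (ℤ.- b ℤ.- (a ℤ.+ b))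
  lemma = solve-∀

φ⁻¹*--φ : ∀ α → φ⁻¹* (-φ α) ≡ -φ (φ⁻¹* α)
φ⁻¹*--φ (a , b) = cong₂ _,_ (lemma a b) refl
  where
  lemma : ∀ a b → ℤ.- b ℤ.- ℤ.- a ≡ ℤ.- (b ℤ.- a)
  lemma = solve-∀

conj-+ : ∀ α β → conj (α +φ β) ≡ conj α +φ conj β
conj-+ (a , a′) (b , b′) = cong₂ _,_ (interchange a b a′ b′) (ℤP.neg-distrib-+ a′ b′)

conj--φ : ∀ α → conj (-φ α) ≡ -φ (conj α)
conj--φ (a , b) = cong₂ _,_ (sym (ℤP.neg-distrib-+ a b)) refl

sub-+φʳ : ∀ a t s → (-φ a) +φ (t -φ s) ≡ t -φ (a +φ s)
sub-+φʳ a t s = trans (+φ-left-comm (-φ a) t (-φ s)) (cong (t +φ_) (sym (-φ-+ a s)))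

sub-cancelˡ : ∀ a t s → 0φ +φ (t -φ s) ≡ (a +φ t) -φ (a +φ s)
sub-cancelˡ a t s = begin
  0φ +φ (t -φ s)                      ≡⟨ cong (_+φ (t -φ s)) (+φ-inverseʳ a) ⟨
  (a -φ a) +φ (t -φ s)                ≡⟨ +φ-interchange a (-φ a) t (-φ s) ⟩
  (a +φ t) +φ ((-φ a) +φ (-φ s))      ≡⟨ cong ((a +φ t) +φ_) (-φ-+ a s) ⟨
  (a +φ t) -φ (a +φ s)                ∎
  where open ≡-Reasoning

sub≡0φ⇒≡ : ∀ t s → t -φ s ≡ 0φ → t ≡ s
sub≡0φ⇒≡ (t , t′) (s , s′) eq =
  cong₂ _,_ (ℤP.i-j≡0⇒i≡j t s (cong proj₁ eq)) (ℤP.i-j≡0⇒i≡j t′ s′ (cong proj₂ eq))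

-- Positivity in ℤ[φ]

φ*^ : ℕ → Zφ → Zφ
φ*^ zero α = α
φ*^ (suc m) α = φ*^ m (φ* α)

φ*^-+ℕ : ∀ m j α → φ*^ (m ℕ.+ j) α ≡ φ*^ j (φ*^ m α)
φ*^-+ℕ zero j α = refl
φ*^-+ℕ (suc m) j α = φ*^-+ℕ m j (φ* α)

φ*^-+ : ∀ m α β → φ*^ m (α +φ β) ≡ φ*^ m α +φ φ*^ m β
φ*^-+ zero α β = refl
φ*^-+ (suc m) α β = trans (cong (φ*^ m) (φ*-+ α β)) (φ*^-+ m (φ* α) (φ* β))

φ*-≡0φ : ∀ α → φ* α ≡ 0φ → α ≡ 0φ
φ*-≡0φ (a , b) eq = cong₂ _,_ a≡0 b≡0
  where
  b≡0 = cong proj₁ eq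
  a≡0 : a ≡ 0ℤ
  a≡0 = trans (sym (ℤP.+-identityʳ a)) (trans (cong (ℤ._+_ a) (sym b≡0)) (cong proj₂ eq))

φ*^-≡0φ : ∀ m α → φ*^ m α ≡ 0φ → α ≡ 0φ
φ*^-≡0φ zero α eq = eq
φ*^-≡0φ (suc m) α eq = φ*-≡0φ α (φ*^-≡0φ m (φ* α) eq)

NonNegCoords : Zφ → Set
NonNegCoords (a , b) = 0ℤ ℤ.≤ a × 0ℤ ℤ.≤ b

NonNegCoords-+ : ∀ {α β} → NonNegCoords α → NonNegCoords β → NonNegCoords (α +φ β)
NonNegCoords-+ (a≥0 , b≥0) (c≥0 , d≥0) = ℤP.+-mono-≤ a≥0 c≥0 , ℤP.+-mono-≤ b≥0 d≥0

NonNegCoords-φ*^ : ∀ m {α} → NonNegCoords α → NonNegCoords (φ*^ m α)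
NonNegCoords-φ*^ zero nn = nn
NonNegCoords-φ*^ (suc m) (a≥0 , b≥0) = NonNegCoords-φ*^ m (b≥0 , ℤP.+-mono-≤ a≥0 b≥0)

+φ-≢0φ : ∀ {α β} → NonNegCoords α → NonNegCoords β → α ≢ 0φ → α +φ β ≢ 0φ
+φ-≢0φ {a , b} {c , d} (a≥0 , b≥0) (c≥0 , d≥0) α≢0 eq =
  α≢0 (cong₂ _,_ (sum≡0 a≥0 c≥0 (cong proj₁ eq)) (sum≡0 b≥0 d≥0 (cong proj₂ eq)))
  where
  sum≡0 : ∀ {x y} → 0ℤ ℤ.≤ x → 0ℤ ℤ.≤ y → x ℤ.+ y ≡ 0ℤ → x ≡ 0ℤ
  sum≡0 {+ zero} _ _ _ = refl
  sum≡0 {+[1+ m ]} {+ n} _ _ ()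

-- α ≥ 0 and α > 0 as real numbers, certified by a power of φ making both
-- coordinates nonnegative
Nonneg : Zφ → Set
Nonneg α = Σ ℕ λ m → NonNegCoords (φ*^ m α)

Positive : Zφ → Set
Positive α = Σ ℕ λ m → NonNegCoords (φ*^ m α) × φ*^ m α ≢ 0φ

Positive⇒Nonneg : ∀ {α} → Positive α → Nonneg α
Positive⇒Nonneg (m , nn , _) = m , nn

Nonneg-0φ : Nonneg 0φ
Nonneg-0φ = 0 , +≤+ z≤n , +≤+ z≤n

NonNegCoords-φ*^-+ʳ : ∀ m j {α} → NonNegCoords (φ*^ m α) → NonNegCoords (φ*^ (m ℕ.+ j) α)
NonNegCoords-φ*^-+ʳ m j {α} nn = subst NonNegCoords (sym (φ*^-+ℕ m j α)) (NonNegCoords-φ*^ j nn)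

NonNegCoords-φ*^-+ˡ : ∀ m j {α} → NonNegCoords (φ*^ j α) → NonNegCoords (φ*^ (m ℕ.+ j) α)
NonNegCoords-φ*^-+ˡ m j {α} nn =
  subst (λ k → NonNegCoords (φ*^ k α)) (ℕP.+-comm j m) (NonNegCoords-φ*^-+ʳ j m nn)

Nonneg-+ : ∀ {α β} → Nonneg α → Nonneg β → Nonneg (α +φ β)
Nonneg-+ {α} {β} (m , α≥0) (j , β≥0) =
  m ℕ.+ j , subst NonNegCoords (sym (φ*^-+ (m ℕ.+ j) α β))
              (NonNegCoords-+ (NonNegCoords-φ*^-+ʳ m j α≥0) (NonNegCoords-φ*^-+ˡ m j β≥0))

Positive-+ : ∀ {α β} → Positive α → Nonneg β → Positive (α +φ β)
Positive-+ {α} {β} (m , α≥0 , α≢0) (j , β≥0) =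
  m ℕ.+ j , subst NonNegCoords (sym eq) (NonNegCoords-+ α′≥0 β′≥0) ,
  subst (_≢ 0φ) (sym eq) (+φ-≢0φ α′≥0 β′≥0 α′≢0)
  where
  eq = φ*^-+ (m ℕ.+ j) α β
  α′≥0 = NonNegCoords-φ*^-+ʳ m j α≥0
  β′≥0 = NonNegCoords-φ*^-+ˡ m j β≥0
  α′≢0 = α≢0 ∘ φ*^-≡0φ j (φ*^ m α) ∘ trans (sym (φ*^-+ℕ m j α))

Positive-φ⁻¹* : ∀ {α} → Positive α → Positive (φ⁻¹* α)
Positive-φ⁻¹* {α} (m , α≥0 , α≢0) =
  suc m , subst NonNegCoords (sym eq) α≥0 , subst (_≢ 0φ) (sym eq) α≢0
  where
  eq : φ*^ m (φ* (φ⁻¹* α)) ≡ φ*^ m α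
  eq = cong (φ*^ m) (φ*-φ⁻¹* α)

Positive-φ*^⁻¹ : ∀ j {α} → Positive (φ*^ j α) → Positive α
Positive-φ*^⁻¹ j {α} (m , α≥0 , α≢0) =
  j ℕ.+ m , subst NonNegCoords (sym eq) α≥0 , subst (_≢ 0φ) (sym eq) α≢0
  where
  eq = φ*^-+ℕ j m α

NonNegCoords⇒Posφ : ∀ {α} → NonNegCoords α → α ≢ 0φ → Posφ α
NonNegCoords⇒Posφ {a , b} (a≥0 , b≥0) α≢0 =
  inj₁ (ℤP.+-mono-≤ (0≤i*j {+ 2} (+≤+ z≤n) a≥0) b≥0 , b≥0 , nonzero)
  where
  nonzero : ¬ ((+ 2) ℤ.* a ℤ.+ b ≡ 0ℤ × b ≡ 0ℤ)
  nonzero (2a+b≡0 , b≡0) = α≢0 (cong₂ _,_ (2*i≡0⇒i≡0 a≥0 2a≡0) b≡0)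
    where
    2a≡0 : (+ 2) ℤ.* a ≡ 0ℤ
    2a≡0 = trans (sym (ℤP.+-identityʳ _)) (subst (λ c → (+ 2) ℤ.* a ℤ.+ c ≡ 0ℤ) b≡0 2a+b≡0)

-- With p = 2a + b and q = b, the clauses of Posφ (a , b) say p + q√5 > 0; for φ* (a , b)
-- the corresponding numbers are p′ = a + 3b and q′ = a + b, and 5q² - p² = p′² - 5q′².
Posφ-cancel-φ* : ∀ α → Posφ (φ* α) → Posφ α
Posφ-cancel-φ* (a , b) (inj₁ (p′≥0 , q′≥0 , ¬p′≡0×q′≡0)) with 0ℤ ℤ.≤? b | 0ℤ ℤ.≤? (+ 2) ℤ.* a ℤ.+ b
... | yes b≥0 | yes p≥0 = inj₁ (p≥0 , b≥0 , λ (p≡0 , b≡0) → ¬p′≡0×q′≡0 (p′≡0 p≡0 b≡0 , q′≡0 p≡0 b≡0))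
  where
  q′≡0 : (+ 2) ℤ.* a ℤ.+ b ≡ 0ℤ → b ≡ 0ℤ → a ℤ.+ b ≡ 0ℤ
  q′≡0 p≡0 b≡0 = 2*i≡0⇒i≡0 q′≥0 (trans (lemma a b) (cong₂ ℤ._+_ p≡0 b≡0))
    where
    lemma : ∀ a b → (+ 2) ℤ.* (a ℤ.+ b) ≡ ((+ 2) ℤ.* a ℤ.+ b) ℤ.+ b
    lemma = solve-∀
  p′≡0 : (+ 2) ℤ.* a ℤ.+ b ≡ 0ℤ → b ≡ 0ℤ → (+ 2) ℤ.* b ℤ.+ (a ℤ.+ b) ≡ 0ℤ
  p′≡0 p≡0 b≡0 = cong₂ ℤ._+_ (cong ((+ 2) ℤ.*_) b≡0) (q′≡0 p≡0 b≡0)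
... | yes b≥0 | no p≱0 = inj₂ (inj₂ (p<0 , b>0 , 0<j-i⇒i<j _ _ (0<-by (lemma a b) 0<rhs)))
  where
  p<0 = ℤP.≰⇒> p≱0
  -p>0 = i<0⇒0<-i p<0
  b>0 : 0ℤ ℤ.< b
  b>0 = 0<-by (decompose a b) (ℤP.+-mono-<-≤ -p>0 (0≤i*j {+ 2} (+≤+ z≤n) q′≥0))
    where
    decompose : ∀ a b → b ≡ ℤ.- ((+ 2) ℤ.* a ℤ.+ b) ℤ.+ (+ 2) ℤ.* (a ℤ.+ b)
    decompose = solve-∀
  0<rhs = 0<i*j {+ 4} (+<+ (s≤s z≤n))
            (ℤP.+-mono-<-≤ (0<i*j -p>0 -p>0)
              (ℤP.+-mono-≤ (0≤i*j {+ 5} (+≤+ z≤n) (0≤i*j q′≥0 q′≥0))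
                           (0≤i*j {+ 5} (+≤+ z≤n) (0≤i*j q′≥0 (ℤP.<⇒≤ -p>0)))))
  lemma : ∀ a b → (+ 5) ℤ.* (b ℤ.* b) ℤ.- ((+ 2) ℤ.* a ℤ.+ b) ℤ.* ((+ 2) ℤ.* a ℤ.+ b)
    ≡ (+ 4) ℤ.* ((ℤ.- ((+ 2) ℤ.* a ℤ.+ b)) ℤ.* (ℤ.- ((+ 2) ℤ.* a ℤ.+ b))
        ℤ.+ ((+ 5) ℤ.* ((a ℤ.+ b) ℤ.* (a ℤ.+ b)) ℤ.+ (+ 5) ℤ.* ((a ℤ.+ b) ℤ.* (ℤ.- ((+ 2) ℤ.* a ℤ.+ b)))))
  lemma = solve-∀
... | no b≱0 | _ = inj₂ (inj₁ (p>0 , b<0 , 0<j-i⇒i<j _ _ (0<-by (lemma a b) 0<rhs)))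
  where
  b<0 = ℤP.≰⇒> b≱0
  -b>0 = i<0⇒0<-i b<0
  p>0 : 0ℤ ℤ.< (+ 2) ℤ.* a ℤ.+ b
  p>0 = 0<-by (decompose a b)
          (ℤP.+-mono-<-≤ (0<i*j {+ 5} (+<+ (s≤s z≤n)) -b>0) (0≤i*j {+ 2} (+≤+ z≤n) p′≥0))
    where
    decompose : ∀ a b → (+ 2) ℤ.* a ℤ.+ b ≡ (+ 5) ℤ.* (ℤ.- b) ℤ.+ (+ 2) ℤ.* ((+ 2) ℤ.* b ℤ.+ (a ℤ.+ b))
    decompose = solve-∀
  0<rhs = ℤP.+-mono-<-≤ (0<i*j {+ 20} (+<+ (s≤s z≤n)) (0<i*j -b>0 -b>0))
            (ℤP.+-mono-≤ (0≤i*j {+ 4} (+≤+ z≤n) (0≤i*j p′≥0 p′≥0))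
                         (0≤i*j {+ 20} (+≤+ z≤n) (0≤i*j p′≥0 (ℤP.<⇒≤ -b>0))))
  lemma : ∀ a b → ((+ 2) ℤ.* a ℤ.+ b) ℤ.* ((+ 2) ℤ.* a ℤ.+ b) ℤ.- (+ 5) ℤ.* (b ℤ.* b)
    ≡ (+ 20) ℤ.* ((ℤ.- b) ℤ.* (ℤ.- b))
        ℤ.+ ((+ 4) ℤ.* (((+ 2) ℤ.* b ℤ.+ (a ℤ.+ b)) ℤ.* ((+ 2) ℤ.* b ℤ.+ (a ℤ.+ b)))
        ℤ.+ (+ 20) ℤ.* (((+ 2) ℤ.* b ℤ.+ (a ℤ.+ b)) ℤ.* (ℤ.- b)))
  lemma = solve-∀
Posφ-cancel-φ* (a , b) (inj₂ (inj₁ (p′>0 , q′<0 , 5q′²<p′²))) =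
  inj₂ (inj₂ (p<0 , b>0 , 0<j-i⇒i<j _ _ (0<-by (norm a b) (i<j⇒0<j-i _ _ 5q′²<p′²))))
  where
  -q′>0 = i<0⇒0<-i q′<0
  b>0 : 0ℤ ℤ.< b
  b>0 = 0<2*i⇒0<i b (0<-by (decompose a b) (ℤP.+-mono-<-≤ p′>0 (ℤP.<⇒≤ -q′>0)))
    where
    decompose : ∀ a b → (+ 2) ℤ.* b ≡ ((+ 2) ℤ.* b ℤ.+ (a ℤ.+ b)) ℤ.+ ℤ.- (a ℤ.+ b)
    decompose = solve-∀
  p<0 : (+ 2) ℤ.* a ℤ.+ b ℤ.< 0ℤ
  p<0 = 0<-i⇒i<0 (0<-by (decompose a b) (ℤP.+-mono-<-≤ -q′>0 (ℤP.+-mono-≤ (ℤP.<⇒≤ -q′>0) (ℤP.<⇒≤ b>0))))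
    where
    decompose : ∀ a b → ℤ.- ((+ 2) ℤ.* a ℤ.+ b) ≡ ℤ.- (a ℤ.+ b) ℤ.+ (ℤ.- (a ℤ.+ b) ℤ.+ b)
    decompose = solve-∀
  norm : ∀ a b → (+ 5) ℤ.* (b ℤ.* b) ℤ.- ((+ 2) ℤ.* a ℤ.+ b) ℤ.* ((+ 2) ℤ.* a ℤ.+ b)
    ≡ ((+ 2) ℤ.* b ℤ.+ (a ℤ.+ b)) ℤ.* ((+ 2) ℤ.* b ℤ.+ (a ℤ.+ b)) ℤ.- (+ 5) ℤ.* ((a ℤ.+ b) ℤ.* (a ℤ.+ b))
  norm = solve-∀
Posφ-cancel-φ* (a , b) (inj₂ (inj₂ (p′<0 , q′>0 , p′²<5q′²))) =
  inj₂ (inj₁ (p>0 , b<0 , 0<j-i⇒i<j _ _ (0<-by (norm a b) (i<j⇒0<j-i _ _ p′²<5q′²))))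
  where
  -p′>0 = i<0⇒0<-i p′<0
  b<0 : b ℤ.< 0ℤ
  b<0 = 0<-i⇒i<0 (0<2*i⇒0<i (ℤ.- b) (0<-by (decompose a b) (ℤP.+-mono-<-≤ q′>0 (ℤP.<⇒≤ -p′>0))))
    where
    decompose : ∀ a b → (+ 2) ℤ.* (ℤ.- b) ≡ (a ℤ.+ b) ℤ.+ ℤ.- ((+ 2) ℤ.* b ℤ.+ (a ℤ.+ b))
    decompose = solve-∀
  p>0 : 0ℤ ℤ.< (+ 2) ℤ.* a ℤ.+ b
  p>0 = 0<-by (decompose a b) (ℤP.+-mono-<-≤ q′>0 (ℤP.+-mono-≤ (ℤP.<⇒≤ q′>0) (ℤP.<⇒≤ (i<0⇒0<-i b<0))))
    where
    decompose : ∀ a b → (+ 2) ℤ.* a ℤ.+ b ≡ (a ℤ.+ b) ℤ.+ ((a ℤ.+ b) ℤ.+ ℤ.- b)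
    decompose = solve-∀
  norm : ∀ a b → ((+ 2) ℤ.* a ℤ.+ b) ℤ.* ((+ 2) ℤ.* a ℤ.+ b) ℤ.- (+ 5) ℤ.* (b ℤ.* b)
    ≡ (+ 5) ℤ.* ((a ℤ.+ b) ℤ.* (a ℤ.+ b)) ℤ.- ((+ 2) ℤ.* b ℤ.+ (a ℤ.+ b)) ℤ.* ((+ 2) ℤ.* b ℤ.+ (a ℤ.+ b))
  norm = solve-∀

Posφ-φ*^ : ∀ m α → Posφ (φ*^ m α) → Posφ α
Posφ-φ*^ zero α pos = pos
Posφ-φ*^ (suc m) α pos = Posφ-cancel-φ* α (Posφ-φ*^ m (φ* α) pos)

Positive⇒Posφ : ∀ {α} → Positive α → Posφ α
Positive⇒Posφ {α} (m , α≥0 , α≢0) = Posφ-φ*^ m α (NonNegCoords⇒Posφ α≥0 α≢0)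

Posφ-diagonal : ∀ m → Posφ (m , m) → 0ℤ ℤ.< m
Posφ-diagonal +[1+ n ] _ = +<+ (s≤s z≤n)
Posφ-diagonal (+ zero) (inj₁ (_ , _ , ¬p≡0×q≡0)) = ⊥-elim (¬p≡0×q≡0 (refl , refl))
Posφ-diagonal (+ zero) (inj₂ (inj₁ (_ , +<+ () , _)))
Posφ-diagonal (+ zero) (inj₂ (inj₂ (_ , +<+ () , _)))
Posφ-diagonal -[1+ n ] (inj₁ (_ , () , _))
Posφ-diagonal -[1+ n ] (inj₂ (inj₁ (() , _ , _)))
Posφ-diagonal -[1+ n ] (inj₂ (inj₂ (_ , () , _)))

-- Bounds on conjugates

record AbsLe (b c : Zφ) : Set where
  constructor absLe
  field
    sub-nonneg : Nonneg (b -φ c)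
    add-nonneg : Nonneg (b +φ c)

record AbsLt (b c : Zφ) : Set where
  constructor absLt
  field
    sub-positive : Positive (b -φ c)
    add-positive : Positive (b +φ c)

AbsLe-0φ : ∀ {b} → Nonneg b → AbsLe b 0φ
AbsLe-0φ {b} b≥0 = absLe b≥0′ b≥0′
  where
  b≥0′ = subst Nonneg (sym (+φ-identityʳ b)) b≥0

AbsLe-refl : ∀ {b} → Nonneg b → AbsLe b b
AbsLe-refl {b} b≥0 = absLe (subst Nonneg (sym (+φ-inverseʳ b)) Nonneg-0φ) (Nonneg-+ b≥0 b≥0)

AbsLe--φ : ∀ {b c} → AbsLe b c → AbsLe b (-φ c)
AbsLe--φ {b} {c} (absLe b-c≥0 b+c≥0) =
  absLe (subst Nonneg (cong (b +φ_) (sym (-φ-involutive c))) b+c≥0) b-c≥0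

AbsLe-+ : ∀ {b b′ c c′} → AbsLe b c → AbsLe b′ c′ → AbsLe (b +φ b′) (c +φ c′)
AbsLe-+ {b} {b′} {c} {c′} (absLe b-c≥0 b+c≥0) (absLe b′-c′≥0 b′+c′≥0) =
  absLe (subst Nonneg (sym sub) (Nonneg-+ b-c≥0 b′-c′≥0)) (subst Nonneg (sym add) (Nonneg-+ b+c≥0 b′+c′≥0))
  where
  add = +φ-interchange b b′ c c′
  sub = trans (cong ((b +φ b′) +φ_) (-φ-+ c c′)) (+φ-interchange b b′ (-φ c) (-φ c′))

Positive+AbsLe⇒AbsLt : ∀ {a b c} → Positive a → AbsLe b c → AbsLt (a +φ b) c
Positive+AbsLe⇒AbsLt {a} {b} {c} a>0 (absLe b-c≥0 b+c≥0) = absLt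
  (subst Positive (sym (+φ-assoc a b (-φ c))) (Positive-+ a>0 b-c≥0))
  (subst Positive (sym (+φ-assoc a b c)) (Positive-+ a>0 b+c≥0))

φ⁻¹*^ : ℕ → Zφ → Zφ
φ⁻¹*^ zero α = α
φ⁻¹*^ (suc n) α = φ⁻¹* (φ⁻¹*^ n α)

Positive-φ⁻¹*^ : ∀ n {α} → Positive α → Positive (φ⁻¹*^ n α)
Positive-φ⁻¹*^ zero α>0 = α>0
Positive-φ⁻¹*^ (suc n) α>0 = Positive-φ⁻¹* (Positive-φ⁻¹*^ n α>0)

φ⁻^ : ℕ → Zφ
φ⁻^ i = φ⁻¹*^ i (φ^ 0)

Nonneg-φ⁻^ : ∀ i → Nonneg (φ⁻^ i)
Nonneg-φ⁻^ i = Positive⇒Nonneg (Positive-φ⁻¹*^ i (0 , (+≤+ z≤n , +≤+ z≤n) , λ ()))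

conj-φ^ : ∀ i → conj (φ^ i) ≡ φ⁻^ i ⊎ conj (φ^ i) ≡ -φ φ⁻^ i
conj-φ^ zero = inj₁ refl
conj-φ^ (suc i) with conj-φ^ i
... | inj₁ eq = inj₂ (trans (conj-φ* (φ^ i)) (cong (-φ_ ∘ φ⁻¹*) eq))
... | inj₂ eq = inj₁ (begin
  conj (φ^ (suc i))          ≡⟨ conj-φ* (φ^ i) ⟩
  -φ (φ⁻¹* (conj (φ^ i)))    ≡⟨ cong (-φ_ ∘ φ⁻¹*) eq ⟩
  -φ (φ⁻¹* (-φ φ⁻^ i))       ≡⟨ cong -φ_ (φ⁻¹*--φ (φ⁻^ i)) ⟩
  -φ (-φ φ⁻^ (suc i))        ≡⟨ -φ-involutive (φ⁻^ (suc i)) ⟩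
  φ⁻^ (suc i)                ∎)
  where open ≡-Reasoning

AbsLe-conj-φ^ : ∀ i → AbsLe (φ⁻^ i) (conj (φ^ i))
AbsLe-conj-φ^ i with conj-φ^ i
... | inj₁ eq = subst (AbsLe (φ⁻^ i)) (sym eq) (AbsLe-refl (Nonneg-φ⁻^ i))
... | inj₂ eq = subst (AbsLe (φ⁻^ i)) (sym eq) (AbsLe--φ (AbsLe-refl (Nonneg-φ⁻^ i)))

Σφ⁻^ : List ℕ → Zφ
Σφ⁻^ [] = 0φ
Σφ⁻^ (i ∷ is) = φ⁻^ i +φ Σφ⁻^ is

Σφ⁻^-map-suc : ∀ is → Σφ⁻^ (map suc is) ≡ φ⁻¹* (Σφ⁻^ is)
Σφ⁻^-map-suc [] = refl
Σφ⁻^-map-suc (i ∷ is) = trans (cong (φ⁻^ (suc i) +φ_) (Σφ⁻^-map-suc is)) (sym (φ⁻¹*-+ (φ⁻^ i) (Σφ⁻^ is)))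

φ⁻¹*^-φ²+Σφ⁻^-upTo : ∀ n → φ⁻¹*^ n φ² +φ Σφ⁻^ (upTo n) ≡ φ²
φ⁻¹*^-φ²+Σφ⁻^-upTo zero = refl
φ⁻¹*^-φ²+Σφ⁻^-upTo (suc n) = begin
  φ⁻¹* v +φ Σφ⁻^ (upTo (suc n))           ≡⟨ cong (λ is′ → φ⁻¹* v +φ Σφ⁻^ (0 ∷ is′)) (List.map-upTo suc n) ⟨
  φ⁻¹* v +φ (φ^ 0 +φ Σφ⁻^ (map suc is))   ≡⟨ cong (λ σ → φ⁻¹* v +φ (φ^ 0 +φ σ)) (Σφ⁻^-map-suc is) ⟩
  φ⁻¹* v +φ (φ^ 0 +φ φ⁻¹* (Σφ⁻^ is))      ≡⟨ +φ-left-comm (φ⁻¹* v) (φ^ 0) _ ⟩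
  φ^ 0 +φ (φ⁻¹* v +φ φ⁻¹* (Σφ⁻^ is))      ≡⟨ cong (φ^ 0 +φ_) (φ⁻¹*-+ v (Σφ⁻^ is)) ⟨
  φ^ 0 +φ φ⁻¹* (v +φ Σφ⁻^ is)             ≡⟨ cong (λ σ → φ^ 0 +φ φ⁻¹* σ) (φ⁻¹*^-φ²+Σφ⁻^-upTo n) ⟩
  φ²                                       ∎
  where
  open ≡-Reasoning
  v = φ⁻¹*^ n φ²
  is = upTo n

AbsLe-Σφ⁻^-upTo⇒AbsLt-φ² : ∀ n {c} → AbsLe (Σφ⁻^ (upTo n)) c → AbsLt φ² c
AbsLe-Σφ⁻^-upTo⇒AbsLt-φ² n {c} bound =
  subst (λ b → AbsLt b c) (φ⁻¹*^-φ²+Σφ⁻^-upTo n)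
    (Positive+AbsLe⇒AbsLt (Positive-φ⁻¹*^ n (0 , (+≤+ z≤n , +≤+ z≤n) , λ ())) bound)

expandφ : List ℕ → List Zφ
expandφ is = expand _+φ_ 0φ (map φ^ is)

∈-expandφ-∷⁻ : ∀ i is {s} → s ∈ expandφ (i ∷ is) →
  s ∈ expandφ is ⊎ ∃ λ s′ → s′ ∈ expandφ is × s ≡ φ^ i +φ s′
∈-expandφ-∷⁻ i is s∈ with ∈-++⁻ (expandφ is) s∈
... | inj₁ s∈′ = inj₁ s∈′
... | inj₂ s∈′ = inj₂ (∈-map⁻ (φ^ i +φ_) s∈′)

AbsLe-conj-∷ : ∀ i is e d {δ} → e +φ d ≡ δ →
  AbsLe (φ⁻^ i) (conj e) → AbsLe (Σφ⁻^ is) (conj d) → AbsLe (Σφ⁻^ (i ∷ is)) (conj δ)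
AbsLe-conj-∷ i is e d refl e-bound d-bound = subst (AbsLe _) (sym (conj-+ e d)) (AbsLe-+ e-bound d-bound)

AbsLe-conj-sub : ∀ is {s t} → s ∈ expandφ is → t ∈ expandφ is → AbsLe (Σφ⁻^ is) (conj (t -φ s))
AbsLe-conj-sub [] (here refl) (here refl) = absLe Nonneg-0φ Nonneg-0φ
AbsLe-conj-sub (i ∷ is) {s} {t} s∈ t∈ with ∈-expandφ-∷⁻ i is s∈ | ∈-expandφ-∷⁻ i is t∈
... | inj₁ s∈′ | inj₁ t∈′ =
  AbsLe-conj-∷ i is 0φ (t -φ s) (+φ-identityˡ (t -φ s))
    (AbsLe-0φ (Nonneg-φ⁻^ i)) (AbsLe-conj-sub is s∈′ t∈′)
... | inj₁ s∈′ | inj₂ (t′ , t∈′ , refl) =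
  AbsLe-conj-∷ i is (φ^ i) (t′ -φ s) (sym (+φ-assoc (φ^ i) t′ (-φ s)))
    (AbsLe-conj-φ^ i) (AbsLe-conj-sub is s∈′ t∈′)
... | inj₂ (s′ , s∈′ , refl) | inj₁ t∈′ =
  AbsLe-conj-∷ i is (-φ φ^ i) (t -φ s′) (sub-+φʳ (φ^ i) t s′)
    (subst (AbsLe (φ⁻^ i)) (sym (conj--φ (φ^ i))) (AbsLe--φ (AbsLe-conj-φ^ i))) (AbsLe-conj-sub is s∈′ t∈′)
... | inj₂ (s′ , s∈′ , refl) | inj₂ (t′ , t∈′ , refl) =
  AbsLe-conj-∷ i is 0φ (t′ -φ s′) (sub-cancelˡ (φ^ i) t′ s′)
    (AbsLe-0φ (Nonneg-φ⁻^ i)) (AbsLe-conj-sub is s∈′ t∈′)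

-- Evaluating φ at 2

φ↦2 : Zφ → ℤ
φ↦2 (x , y) = x ℤ.+ (+ 2) ℤ.* y

φ↦2-+ : ∀ α β → φ↦2 (α +φ β) ≡ φ↦2 α ℤ.+ φ↦2 β
φ↦2-+ (a , b) (c , d) = lemma a b c d
  where
  lemma : ∀ a b c d → (a ℤ.+ c) ℤ.+ (+ 2) ℤ.* (b ℤ.+ d) ≡ (a ℤ.+ (+ 2) ℤ.* b) ℤ.+ (c ℤ.+ (+ 2) ℤ.* d)
  lemma = solve-∀

φ↦2--φ : ∀ α → φ↦2 (-φ α) ≡ ℤ.- φ↦2 α
φ↦2--φ (a , b) = lemma a b
  where
  lemma : ∀ a b → ℤ.- a ℤ.+ (+ 2) ℤ.* ℤ.- b ≡ ℤ.- (a ℤ.+ (+ 2) ℤ.* b)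
  lemma = solve-∀

φ↦2-sub : ∀ α β → φ↦2 (α -φ β) ≡ φ↦2 α ℤ.- φ↦2 β
φ↦2-sub α β = trans (φ↦2-+ α (-φ β)) (cong (ℤ._+_ (φ↦2 α)) (φ↦2--φ β))

φ^-suc : ∀ i → φ^ (suc i) ≡ (+ fib i , + fib (suc i))
φ^-suc zero = refl
φ^-suc (suc i) = trans (cong φ* (φ^-suc i)) (cong (+ fib (suc i) ,_) (sym (ℤP.pos-+ (fib i) (fib (suc i)))))

φ↦2-φ^ : ∀ i → φ↦2 (φ^ i) ≡ + fib (suc (suc i))
φ↦2-φ^ zero = refl
φ↦2-φ^ (suc i) = begin
  φ↦2 (φ^ (suc i))                            ≡⟨ cong φ↦2 (φ^-suc i) ⟩
  + fib i ℤ.+ (+ 2) ℤ.* + fib (suc i)         ≡⟨ cong (ℤ._+_ (+ fib i)) (ℤP.pos-* 2 (fib (suc i))) ⟨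
  + fib i ℤ.+ + (2 ℕ.* fib (suc i))           ≡⟨ ℤP.pos-+ (fib i) (2 ℕ.* fib (suc i)) ⟨
  + (fib i ℕ.+ 2 ℕ.* fib (suc i))             ≡⟨ cong +_ (lemma (fib i) (fib (suc i))) ⟩
  + fib (suc (suc (suc i)))                   ∎
  where
  open ≡-Reasoning
  lemma : ∀ a b → a ℕ.+ 2 ℕ.* b ≡ b ℕ.+ (a ℕ.+ b)
  lemma = ℕSolver.solve-∀

-- x + 2y = 0 makes conj (x , y) = -y φ², so φ² ± conj (x , y) = (1 ∓ y) φ² and |y| < 1.
φ↦2≡0⇒≡0φ : ∀ {d} → AbsLt φ² (conj d) → φ↦2 d ≡ 0ℤ → d ≡ 0φ
φ↦2≡0⇒≡0φ {x , y} (absLt φ²-d̄>0 φ²+d̄>0) x+2y≡0 = cong₂ _,_ x≡0 y≡0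
  where
  x+y≡-y : x ℤ.+ y ≡ ℤ.- y
  x+y≡-y = trans (lemma x y) (trans (cong (ℤ._+ ℤ.- y) x+2y≡0) (ℤP.+-identityˡ (ℤ.- y)))
    where
    lemma : ∀ x y → x ℤ.+ y ≡ (x ℤ.+ (+ 2) ℤ.* y) ℤ.+ ℤ.- y
    lemma = solve-∀
  diagonal : ∀ w → Posφ (+ 1 ℤ.+ w , + 1 ℤ.+ w) → 0ℤ ℤ.≤ w
  diagonal w = 0<1+i⇒0≤i w ∘ Posφ-diagonal (+ 1 ℤ.+ w)
  -y≥0 : 0ℤ ℤ.≤ ℤ.- y
  -y≥0 = diagonal (ℤ.- y) (subst (λ w → Posφ (+ 1 ℤ.+ w , + 1 ℤ.+ ℤ.- y)) x+y≡-y (Positive⇒Posφ φ²+d̄>0))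
  y≥0 : 0ℤ ℤ.≤ y
  y≥0 = subst (0ℤ ℤ.≤_) (ℤP.neg-involutive y) (diagonal (ℤ.- ℤ.- y)
          (subst (λ w → Posφ (+ 1 ℤ.+ ℤ.- w , + 1 ℤ.+ ℤ.- ℤ.- y)) x+y≡-y (Positive⇒Posφ φ²-d̄>0)))
  y≡0 : y ≡ 0ℤ
  y≡0 = ℤP.≤-antisym (ℤP.neg-cancel-≤ {0ℤ} {y} -y≥0) y≥0
  x≡0 : x ≡ 0ℤ
  x≡0 = trans (sym (ℤP.+-identityʳ x)) (subst (λ y → x ℤ.+ (+ 2) ℤ.* y ≡ 0ℤ) y≡0 x+2y≡0)

φ*⁴-decomposition : ∀ d → φ*^ 4 d ≡ (φ² +φ conj d) +φ (φ↦2 d ℤ.- + 1 , (+ 3) ℤ.* φ↦2 d ℤ.- + 1)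
φ*⁴-decomposition (x , y) = cong₂ _,_ (first x y) (second x y)
  where
  first : ∀ x y → (x ℤ.+ y) ℤ.+ (y ℤ.+ (x ℤ.+ y))
    ≡ (+ 1 ℤ.+ (x ℤ.+ y)) ℤ.+ ((x ℤ.+ (+ 2) ℤ.* y) ℤ.- + 1)
  first = solve-∀
  second : ∀ x y → (y ℤ.+ (x ℤ.+ y)) ℤ.+ ((x ℤ.+ y) ℤ.+ (y ℤ.+ (x ℤ.+ y)))
    ≡ (+ 1 ℤ.+ ℤ.- y) ℤ.+ ((+ 3) ℤ.* (x ℤ.+ (+ 2) ℤ.* y) ℤ.- + 1)
  second = solve-∀

φ↦2>0⇒Posφ : ∀ {d} → Positive (φ² +φ conj d) → 0ℤ ℤ.< φ↦2 d → Posφ d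
φ↦2>0⇒Posφ {d} φ²+d̄>0 k>0 =
  Positive⇒Posφ (Positive-φ*^⁻¹ 4 {d} (subst Positive (sym (φ*⁴-decomposition d))
    (Positive-+ φ²+d̄>0 (0 , nonneg (φ↦2 d) k>0))))
  where
  nonneg : ∀ k → 0ℤ ℤ.< k → NonNegCoords (k ℤ.- + 1 , (+ 3) ℤ.* k ℤ.- + 1)
  nonneg (+ zero) (+<+ ())
  nonneg +[1+ j ] _ = +≤+ z≤n , +≤+ z≤n

φ↦2ℕ : Zφ → ℕ
φ↦2ℕ t = ℤ.∣ φ↦2 t ∣

map-+-termsI : ∀ n → map +_ (termsI n) ≡ map φ↦2 (termsG n)
map-+-termsI n = begin
  map +_ (termsI n)                             ≡⟨ expand-map +_ refl ℤP.pos-+ (fibs n) ⟩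
  expand ℤ._+_ 0ℤ (map +_ (fibs n))             ≡⟨ cong (expand ℤ._+_ 0ℤ) exponents ⟩
  expand ℤ._+_ 0ℤ (map φ↦2 (map φ^ (upTo n)))   ≡⟨ expand-map φ↦2 refl φ↦2-+ (map φ^ (upTo n)) ⟨
  map φ↦2 (termsG n)                            ∎
  where
  open ≡-Reasoning
  exponents : map +_ (fibs n) ≡ map φ↦2 (map φ^ (upTo n))
  exponents = trans (sym (List.map-∘ (upTo n)))
                (trans (List.map-cong (sym ∘ φ↦2-φ^) (upTo n)) (List.map-∘ (upTo n)))

termsI≡map-φ↦2ℕ : ∀ n → termsI n ≡ map φ↦2ℕ (termsG n)
termsI≡map-φ↦2ℕ n = begin
  termsI n                          ≡⟨ List.map-id (termsI n) ⟨
  map (ℤ.∣_∣ ∘ +_) (termsI n)       ≡⟨ List.map-∘ (termsI n) ⟩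
  map ℤ.∣_∣ (map +_ (termsI n))     ≡⟨ cong (map ℤ.∣_∣) (map-+-termsI n) ⟩
  map ℤ.∣_∣ (map φ↦2 (termsG n))    ≡⟨ List.map-∘ (termsG n) ⟨
  map φ↦2ℕ (termsG n)               ∎
  where open ≡-Reasoning

φ↦2-termsG : ∀ n {t} → t ∈ termsG n → φ↦2 t ≡ + φ↦2ℕ t
φ↦2-termsG n {t} t∈ with ∈-map⁻ +_ (subst (φ↦2 t ∈_) (sym (map-+-termsI n)) (∈-map⁺ φ↦2 t∈))
... | _ , _ , φ↦2t≡k = trans φ↦2t≡k (cong (+_ ∘ ℤ.∣_∣) (sym φ↦2t≡k))

module _ (n : ℕ) {s t : Zφ} (s∈ : s ∈ termsG n) (t∈ : t ∈ termsG n) where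

  private
    conj-bound : AbsLt φ² (conj (t -φ s))
    conj-bound = AbsLe-Σφ⁻^-upTo⇒AbsLt-φ² n (AbsLe-conj-sub (upTo n) s∈ t∈)

    φ↦2-sub-ℕ : φ↦2 (t -φ s) ≡ + φ↦2ℕ t ℤ.- + φ↦2ℕ s
    φ↦2-sub-ℕ = trans (φ↦2-sub t s) (cong₂ ℤ._-_ (φ↦2-termsG n t∈) (φ↦2-termsG n s∈))

  φ↦2ℕ-injective : φ↦2ℕ s ≡ φ↦2ℕ t → s ≡ t
  φ↦2ℕ-injective eq = sym (sub≡0φ⇒≡ t s (φ↦2≡0⇒≡0φ {t -φ s} conj-bound φ↦2-sub≡0))
    where
    φ↦2-sub≡0 : φ↦2 (t -φ s) ≡ 0ℤ
    φ↦2-sub≡0 = trans φ↦2-sub-ℕ (trans (cong (λ k → + φ↦2ℕ t ℤ.- + k) eq) (ℤP.+-inverseʳ (+ φ↦2ℕ t)))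

  φ↦2ℕ-reflects-< : φ↦2ℕ s < φ↦2ℕ t → s <φ t
  φ↦2ℕ-reflects-< lt =
    φ↦2>0⇒Posφ {t -φ s} (AbsLt.add-positive conj-bound)
      (subst (0ℤ ℤ.<_) (sym φ↦2-sub-ℕ) (i<j⇒0<j-i _ _ (+<+ lt)))

corollary1 : (n : ℕ) →
    (Σ (List ℕ) λ cs →
        IsCoeffSeq _<φ_ _≟φ_ (termsG n) cs
      × IsCoeffSeq ℕ._<_ ℕ._≟_ (termsI n) cs)
    × (∀ k → coeff ℕ._≟_ (termsI n) k ≡ 0 → degℕ (termsI n) ℕ.< k)
corollary1 n = (cs , coeffSeqG , coeffSeqI) , λ _ → coeff≡0⇒degℕ< (termsI n) D exponent≤D ≤D⇒exponent
  where
  D = sum (fibs n)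
  exponent≤D : ∀ {k} → k ∈ termsI n → k ≤ D
  exponent≤D = ∈-expand⇒≤-sum (fibs n)
  ≤D⇒exponent : ∀ {k} → k ≤ D → k ∈ termsI n
  ≤D⇒exponent = SubsetSumsCover-fibs n
  cs = map (coeff ℕ._≟_ (termsI n)) (upTo (suc D))
  coeffSeqI : IsCoeffSeq ℕ._<_ ℕ._≟_ (termsI n) cs
  coeffSeqI = IsCoeffSeq-interval (termsI n) D exponent≤D ≤D⇒exponent
  coeffSeqG : IsCoeffSeq _<φ_ _≟φ_ (termsG n) cs
  coeffSeqG = IsCoeffSeq-map⁻ _≟φ_ φ↦2ℕ (termsG n) (φ↦2ℕ-injective n) (φ↦2ℕ-reflects-< n)
                (subst (λ ts → IsCoeffSeq ℕ._<_ ℕ._≟_ ts cs) (termsI≡map-φ↦2ℕ n) coeffSeqI)
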